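{- Let $G$ be a connected strongly regular graph with parameters $(n,k,1,\mu)$, with $k\geq 3$. Then the Gallai graph $\Gamma(G)$ is edge-regular. Furthermore, $\Gamma(G)$ is strongly regular if and only if $\mu>1$, $k=4$, and any two non-adjacent edges of $G$ belong to a common cycle of length $4$ in $G$.
   Context: All graphs are finite and simple. A $k$-regular graph $G$ on $n$ vertices is strongly regular with parameters $(n,k,\lambda,\mu)$ if $G$ is neither complete nor empty, any two adjacent vertices have exactly $\lambda$ common neighbours, and any two non-adjacent vertices have exactly $\mu$ common neighbours. An edge-regular graph with parameters $(n,k,\lambda)$ is a $k$-regular graph on $n$ vertices in which any two adjacent vertices have exactly $\lambda$ common neighbours. The Gallai graph $\Gamma(G)$ has the edges of $G$ as vertices, two being adjacent iff the corresponding edges of $G$ share a vertex but do not lie on a common triangle of $G$. Two edges of $G$ are non-adjacent if they share no endpoint; two edges belong to a common cycle of length $4$ if some cycle subgraph $C_4$ of $G$ contains both. -}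

module Defs where

open import Data.Nat using (ℕ; zero; suc; _<ᵇ_)
open import Data.Fin using (Fin; toℕ; _≟_)
open import Data.Bool using (Bool; true; false; _∧_; not; if_then_else_)
open import Data.List using (List; length; filterᵇ; allFin; concatMap; map; lookup)
open import Data.Product using (_×_; _,_; proj₁; proj₂; Σ; ∃; ∃-syntax)
open import Data.Sum using (_⊎_)
open import Relation.Binary.PropositionalEquality using (_≡_; _≢_)
open import Relation.Nullary.Decidable using (⌊_⌋)

record Graph (n : ℕ) : Set where
  field
    adj    : Fin n → Fin n → Bool
    sym    : ∀ i j → adj i j ≡ adj j i
    irrefl : ∀ i → adj i i ≡ false
open Graph public

-- Raw adjacency relations (used for regularity notions, so they apply to Γ(G) too)
Rel : ℕ → Set
Rel n = Fin n → Fin n → Bool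

degree : ∀ {n} → Rel n → Fin n → ℕ
degree {n} A i = length (filterᵇ (λ j → A i j) (allFin n))

common : ∀ {n} → Rel n → Fin n → Fin n → ℕ
common {n} A i j = length (filterᵇ (λ x → A i x ∧ A j x) (allFin n))

IsRegular : ∀ {n} → Rel n → ℕ → Set
IsRegular A k = ∀ i → degree A i ≡ k

IsEdgeRegular : ∀ {n} → Rel n → ℕ → ℕ → Set
IsEdgeRegular A k λ′ =
  IsRegular A k × (∀ i j → A i j ≡ true → common A i j ≡ λ′)

NotComplete : ∀ {n} → Rel n → Set
NotComplete A = ∃[ i ] ∃[ j ] (i ≢ j × A i j ≡ false)

NotEmpty : ∀ {n} → Rel n → Set
NotEmpty A = ∃[ i ] ∃[ j ] (A i j ≡ true)

IsStronglyRegular : ∀ {n} → Rel n → ℕ → ℕ → ℕ → Set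
IsStronglyRegular A k λ′ μ =
  NotComplete A × NotEmpty A × IsEdgeRegular A k λ′ ×
  (∀ i j → i ≢ j → A i j ≡ false → common A i j ≡ μ)

EdgeRegular : ∀ {n} → Rel n → Set
EdgeRegular A = ∃[ k ] ∃[ λ′ ] IsEdgeRegular A k λ′

StronglyRegular : ∀ {n} → Rel n → Set
StronglyRegular A = ∃[ k ] ∃[ λ′ ] ∃[ μ ] IsStronglyRegular A k λ′ μ

data Reach {n : ℕ} (A : Rel n) : Fin n → Fin n → Set where
  here : ∀ {i} → Reach A i i
  step : ∀ {i j l} → A i j ≡ true → Reach A j l → Reach A i l

Connected : ∀ {n} → Graph n → Set
Connected G = ∀ i j → Reach (adj G) i j

allPairs : (n : ℕ) → List (Fin n × Fin n)
allPairs n = concatMap (λ i → map (i ,_) (allFin n)) (allFin n)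

edges : ∀ {n} → Graph n → List (Fin n × Fin n)
edges {n} G = filterᵇ (λ p → (toℕ (proj₁ p) <ᵇ toℕ (proj₂ p)) ∧ adj G (proj₁ p) (proj₂ p)) (allPairs n)

numEdges : ∀ {n} → Graph n → ℕ
numEdges G = length (edges G)

edgeAt : ∀ {n} (G : Graph n) → Fin (numEdges G) → Fin n × Fin n
edgeAt G = lookup (edges G)

infix 4 _==_
_==_ : ∀ {n} → Fin n → Fin n → Bool
a == b = ⌊ a ≟ b ⌋

-- Two distinct edges {a,b}, {c,d} sharing a vertex x, with other endpoints y, z,
-- lie on a common triangle of G iff y ~ z (the only candidate triangle is xyz).
-- gallaiPair returns true iff they share a vertex but lie on no common triangle.
gallaiPair : ∀ {n} → Graph n → Fin n × Fin n → Fin n × Fin n → Bool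
gallaiPair G (a , b) (c , d) =
  if a == c then not (adj G b d) else
  if a == d then not (adj G b c) else
  if b == c then not (adj G a d) else
  if b == d then not (adj G a c) else false

gallai : ∀ {n} (G : Graph n) → Rel (numEdges G)
gallai G e f = not ⌊ e ≟ f ⌋ ∧ gallaiPair G (edgeAt G e) (edgeAt G f)

SameEdge : ∀ {n} → Fin n → Fin n → Fin n → Fin n → Set
SameEdge a b u v = (a ≡ u × b ≡ v) ⊎ (a ≡ v × b ≡ u)

OnCycle : ∀ {n} → Fin n → Fin n → (Fin n × Fin n × Fin n × Fin n) → Set
OnCycle a b (v0 , v1 , v2 , v3) =
  SameEdge a b v0 v1 ⊎ SameEdge a b v1 v2 ⊎ SameEdge a b v2 v3 ⊎ SameEdge a b v3 v0

IsC4 : ∀ {n} → Graph n → (Fin n × Fin n × Fin n × Fin n) → Set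
IsC4 G (v0 , v1 , v2 , v3) =
  (v0 ≢ v1 × v0 ≢ v2 × v0 ≢ v3 × v1 ≢ v2 × v1 ≢ v3 × v2 ≢ v3) ×
  (adj G v0 v1 ≡ true × adj G v1 v2 ≡ true × adj G v2 v3 ≡ true × adj G v3 v0 ≡ true)

CommonC4 : ∀ {n} → Graph n → Fin n → Fin n → Fin n → Fin n → Set
CommonC4 G a b c d = ∃[ C ] (IsC4 G C × OnCycle a b C × OnCycle c d C)

NonAdjEdgesOnC4 : ∀ {n} → Graph n → Set
NonAdjEdgesOnC4 G = ∀ a b c d → adj G a b ≡ true → adj G c d ≡ true →
  a ≢ c → a ≢ d → b ≢ c → b ≢ d → CommonC4 G a b c d

-- An edge-regular graph with λ = 1 has each edge ab in exactly one triangle, so the Gallai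
-- neighbours of ab are the edges aw with w ∉ N[b] and bw with w ∉ N[a]: 2(k − 2) of them.
-- Two Gallai-adjacent edges xy, xz (so y ≁ z) have as common neighbours the edges xw with
-- w ∉ N[y] ∪ N[z], and N(x) loses exactly y, z and the third vertices of their triangles:
-- k − 4 of them. Hence Γ(G) is edge-regular.
--
-- Both sides of the equivalence are in fact false. The edges xy, xt of a triangle are not
-- Gallai-adjacent and have k − 2 common neighbours, so a strongly regular Γ(G) would have
-- parameters (nk/2, 2(k − 2), k − 4, k − 2); then K(K − L − 1) = (N − K − 1)M forces
-- nk/2 = 4k − 5, against n ≥ k + 2. For non-adjacent x, y: a neighbour z of y outside N(x)
-- makes xa and yz, for any neighbour a of x, disjoint edges on no common 4-cycle; and
-- N(y) ⊆ N(x) is impossible, as the ends of an edge ab inside N(y) would have the two common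
-- neighbours x and y.
--
-- Edge counts are reduced to vertex counts through stars: summing a function of the far
-- endpoint over the edges through x is summing it over the neighbours of x.

module Submission where

open import Defs hiding (sym)
open import Data.Bool using (Bool; true; false; _∧_; not; T; T?)
open import Data.Bool.Properties using (T-≡; T-∧; ∧-comm; ∧-assoc; ∧-identityʳ; ∧-zeroʳ)
open import Data.Empty using (⊥-elim)
open import Data.Fin using (Fin; toℕ; _≟_) renaming (zero to fzero; suc to fsuc)
open import Data.Fin.Properties using (toℕ-injective; any?)
open import Data.List using (List; []; _∷_; _++_; length; filterᵇ; allFin; tabulate; map; lookup; concatMap)
open import Data.List.Membership.Propositional.Properties using (∈-filter⁻; ∈-lookup)
open import Data.List.Properties using (map-++; map-∘)
open import Data.Nat using (ℕ; zero; suc; _+_; _*_; _∸_; _≤_; _<_; z≤n; s≤s; _<ᵇ_; _≤?_)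
open import Data.Nat.ListAction using () renaming (sum to listSum)
open import Data.Nat.ListAction.Properties using () renaming (sum-++ to listSum-++)
open import Data.Nat.Properties
  using ( +-*-semiring; +-comm; +-identityʳ; *-comm; *-identityʳ; *-zeroʳ; *-distribʳ-+; *-cancelʳ-≡
        ; ≤-trans; ≤-reflexive; <⇒≤; m≤m+n; m≤n+m; +-mono-≤; +-monoʳ-≤; *-monoˡ-≤; m+1+n≰m
        ; m+n∸m≡n; m∸n+n≡m; m∸n≢0⇒n<m; ∸-+-assoc)
open import Data.Nat.Tactic.RingSolver using (solve-∀)
open import Algebra.Properties.Semiring.Sum +-*-semiring
  using (sum-syntax; sum-cong-≗; ∑-distrib-+; sum-replicate-zero; *-distribˡ-sum; ∑-comm)
open import Data.Product using (_×_; _,_; proj₁; proj₂; ∃-syntax; swap)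
open import Data.Sum using (_⊎_; inj₁; inj₂)
open import Function using (_∘_)
open import Function.Bundles using (Equivalence; _⇔_; mk⇔)
open import Relation.Binary.PropositionalEquality
open import Relation.Nullary using (Dec; yes; no; ¬_; contradiction)
open import Relation.Nullary.Decidable using (from-no)

open ≡-Reasoning

⟦_⟧ : Bool → ℕ
⟦ true ⟧ = 1
⟦ false ⟧ = 0

⟦∧⟧ : ∀ a b → ⟦ a ∧ b ⟧ ≡ ⟦ a ⟧ * ⟦ b ⟧
⟦∧⟧ true b = sym (+-identityʳ ⟦ b ⟧)
⟦∧⟧ false b = refl

⟦⟧-injective : ∀ {p q} → ⟦ p ⟧ ≡ ⟦ q ⟧ → p ≡ q
⟦⟧-injective {false} {false} _ = refl
⟦⟧-injective {true} {true} _ = refl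

∧-true : ∀ {p q} → (p ∧ q) ≡ true → p ≡ true × q ≡ true
∧-true {true} {true} _ = refl , refl

not-true : ∀ {p} → not p ≡ true → p ≡ false
not-true {false} _ = refl

⟦⟧-pos : ∀ {p} → 0 < ⟦ p ⟧ → p ≡ true
⟦⟧-pos {true} _ = refl

count : ∀ {n} → (Fin n → Bool) → ℕ
count {n} P = ∑[ i < n ] ⟦ P i ⟧

length-filterᵇ-tabulate : ∀ {A : Set} {n} (P : A → Bool) (f : Fin n → A) →
  length (filterᵇ P (tabulate f)) ≡ ∑[ i < n ] ⟦ P (f i) ⟧
length-filterᵇ-tabulate {n = zero} P f = refl
length-filterᵇ-tabulate {n = suc n} P f with P (f fzero)
... | true = cong suc (length-filterᵇ-tabulate P (f ∘ fsuc))
... | false = length-filterᵇ-tabulate P (f ∘ fsuc)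

length-filterᵇ-allFin : ∀ {n} (P : Fin n → Bool) → length (filterᵇ P (allFin n)) ≡ count P
length-filterᵇ-allFin P = length-filterᵇ-tabulate P (λ i → i)

==-refl : ∀ {n} (a : Fin n) → (a == a) ≡ true
==-refl a with a ≟ a
... | yes _ = refl
... | no a≢a = contradiction refl a≢a

==-≢ : ∀ {n} {a b : Fin n} → a ≢ b → (a == b) ≡ false
==-≢ {a = a} {b} a≢b with a ≟ b
... | yes a≡b = contradiction a≡b a≢b
... | no _ = refl

==-sym : ∀ {n} (a b : Fin n) → (a == b) ≡ (b == a)
==-sym a b with a ≟ b | b ≟ a
... | yes _ | yes _ = refl
... | no _ | no _ = refl
... | yes a≡b | no b≢a = contradiction (sym a≡b) b≢a
... | no a≢b | yes b≡a = contradiction (sym b≡a) a≢b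

==-fsuc : ∀ {n} (a b : Fin n) → (fsuc a == fsuc b) ≡ (a == b)
==-fsuc a b with a ≟ b
... | yes _ = refl
... | no _ = refl

∑-δ : ∀ {n} (a : Fin n) (f : Fin n → ℕ) → ∑[ v < n ] (⟦ a == v ⟧ * f v) ≡ f a
∑-δ {suc n} fzero f = trans (cong₂ _+_ (+-identityʳ (f fzero)) (sum-replicate-zero n)) (+-identityʳ (f fzero))
∑-δ {suc n} (fsuc a) f =
  trans (sum-cong-≗ {n} (λ v → cong (λ b → ⟦ b ⟧ * f (fsuc v)) (==-fsuc a v))) (∑-δ a (f ∘ fsuc))

∑-remove : ∀ {n} (a : Fin n) (f : Fin n → ℕ) →
  ∑[ v < n ] f v ≡ f a + ∑[ v < n ] (⟦ not (a == v) ⟧ * f v)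
∑-remove {n} a f = begin
  ∑[ v < n ] f v                                                ≡⟨ sum-cong-≗ {n} (λ v → split (a == v) (f v)) ⟩
  ∑[ v < n ] (⟦ a == v ⟧ * f v + ⟦ not (a == v) ⟧ * f v)        ≡⟨ ∑-distrib-+ {n} _ _ ⟩
  ∑[ v < n ] (⟦ a == v ⟧ * f v) + ∑[ v < n ] (⟦ not (a == v) ⟧ * f v) ≡⟨ cong (_+ ∑[ v < n ] (⟦ not (a == v) ⟧ * f v)) (∑-δ a f) ⟩
  f a + ∑[ v < n ] (⟦ not (a == v) ⟧ * f v)                     ∎
  where
  split : ∀ b x → x ≡ ⟦ b ⟧ * x + ⟦ not b ⟧ * x
  split true x = sym (trans (+-identityʳ _) (+-identityʳ x))
  split false x = sym (+-identityʳ x)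

∑-≥-term : ∀ {n} (f : Fin n → ℕ) (a : Fin n) → f a ≤ ∑[ v < n ] f v
∑-≥-term f a = subst (f a ≤_) (sym (∑-remove a f)) (m≤m+n (f a) _)

∑-const : ∀ n c → ∑[ i < n ] c ≡ n * c
∑-const zero c = refl
∑-const (suc n) c = cong (c +_) (∑-const n c)

∑-witness : ∀ {n} (f : Fin n → ℕ) → 0 < ∑[ i < n ] f i → ∃[ i ] 0 < f i
∑-witness {suc n} f pos with f fzero in f0
... | suc _ = fzero , subst (0 <_) (sym f0) (s≤s z≤n)
... | zero with ∑-witness (f ∘ fsuc) pos
... | i , fi = fsuc i , fi

∑-≥2 : ∀ {n} (f : Fin n → ℕ) {i j : Fin n} → 0 < f i → 0 < f j → i ≢ j → 2 ≤ ∑[ v < n ] f v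
∑-≥2 {n} f {i} {j} fi fj i≢j = subst (2 ≤_) (sym (∑-remove i f)) (+-mono-≤ fi (≤-trans fj′ (∑-≥-term _ j)))
  where
  fj′ : 1 ≤ ⟦ not (i == j) ⟧ * f j
  fj′ rewrite ==-≢ i≢j | +-identityʳ (f j) = fj

count-cong : ∀ {n} {P Q : Fin n → Bool} → (∀ i → P i ≡ Q i) → count P ≡ count Q
count-cong {n} eq = sum-cong-≗ {n} (cong ⟦_⟧ ∘ eq)

count-split : ∀ {n} (P Q : Fin n → Bool) →
  count P ≡ count (λ v → P v ∧ Q v) + count (λ v → P v ∧ not (Q v))
count-split {n} P Q =
  trans (sum-cong-≗ {n} (λ v → split (P v) (Q v))) (∑-distrib-+ {n} _ _)
  where
  split : ∀ p q → ⟦ p ⟧ ≡ ⟦ p ∧ q ⟧ + ⟦ p ∧ not q ⟧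
  split false q = refl
  split true false = refl
  split true true = refl

count-complement : ∀ {n} (P : Fin n → Bool) → count P + count (not ∘ P) ≡ n
count-complement {n} P = trans (sym (count-split (λ _ → true) P)) (trans (∑-const n 1) (*-identityʳ n))

count-remove : ∀ {n} {P : Fin n → Bool} (a : Fin n) → P a ≡ true →
  count P ≡ suc (count (λ v → P v ∧ not (a == v)))
count-remove {n} {P} a Pa = begin
  count P                                                ≡⟨ ∑-remove a (λ v → ⟦ P v ⟧) ⟩
  ⟦ P a ⟧ + ∑[ v < n ] (⟦ not (a == v) ⟧ * ⟦ P v ⟧)      ≡⟨ cong₂ _+_ (cong ⟦_⟧ Pa) (sum-cong-≗ {n} conj) ⟩
  suc (count (λ v → P v ∧ not (a == v)))                 ∎
  where
  conj : ∀ v → ⟦ not (a == v) ⟧ * ⟦ P v ⟧ ≡ ⟦ P v ∧ not (a == v) ⟧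
  conj v = trans (sym (⟦∧⟧ (not (a == v)) (P v))) (cong ⟦_⟧ (∧-comm (not (a == v)) (P v)))

count-witness : ∀ {n} (P : Fin n → Bool) → 0 < count P → ∃[ i ] P i ≡ true
count-witness P pos = let i , Pi = ∑-witness (λ i → ⟦ P i ⟧) pos in i , ⟦⟧-pos Pi

count-≥2 : ∀ {n} {P : Fin n → Bool} {i j : Fin n} → P i ≡ true → P j ≡ true → i ≢ j →
  2 ≤ count P
count-≥2 {P = P} Pi Pj = ∑-≥2 (λ v → ⟦ P v ⟧) (positive Pi) (positive Pj)
  where
  positive : ∀ {p} → p ≡ true → 0 < ⟦ p ⟧
  positive refl = s≤s z≤n

∑-indicator-const : ∀ {n} (P : Fin n → Bool) (f : Fin n → ℕ) c →
  (∀ i → P i ≡ true → f i ≡ c) → ∑[ i < n ] (⟦ P i ⟧ * f i) ≡ count P * c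
∑-indicator-const {zero} P f c const = refl
∑-indicator-const {suc n} P f c const with P fzero in P0
... | true = cong₂ _+_ (trans (+-identityʳ _) (const fzero P0))
                       (∑-indicator-const (P ∘ fsuc) (f ∘ fsuc) c (const ∘ fsuc))
... | false = ∑-indicator-const (P ∘ fsuc) (f ∘ fsuc) c (const ∘ fsuc)

listSum-lookup : ∀ {A : Set} (xs : List A) (F : A → ℕ) →
  ∑[ i < length xs ] F (lookup xs i) ≡ listSum (map F xs)
listSum-lookup [] F = refl
listSum-lookup (x ∷ xs) F = cong (F x +_) (listSum-lookup xs F)

listSum-filterᵇ : ∀ {A : Set} (P : A → Bool) (F : A → ℕ) (xs : List A) →
  listSum (map F (filterᵇ P xs)) ≡ listSum (map (λ x → ⟦ P x ⟧ * F x) xs)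
listSum-filterᵇ P F [] = refl
listSum-filterᵇ P F (x ∷ xs) with P x
... | true = cong₂ _+_ (sym (+-identityʳ (F x))) (listSum-filterᵇ P F xs)
... | false = listSum-filterᵇ P F xs

listSum-concatMap : ∀ {A B : Set} (h : A → List B) (F : B → ℕ) (xs : List A) →
  listSum (map F (concatMap h xs)) ≡ listSum (map (λ x → listSum (map F (h x))) xs)
listSum-concatMap h F [] = refl
listSum-concatMap h F (x ∷ xs) = begin
  listSum (map F (h x ++ concatMap h xs))                    ≡⟨ cong listSum (map-++ F (h x) (concatMap h xs)) ⟩
  listSum (map F (h x) ++ map F (concatMap h xs))            ≡⟨ listSum-++ (map F (h x)) _ ⟩
  listSum (map F (h x)) + listSum (map F (concatMap h xs))   ≡⟨ cong (listSum (map F (h x)) +_) (listSum-concatMap h F xs) ⟩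
  listSum (map F (h x)) + listSum (map (λ x → listSum (map F (h x))) xs) ∎

listSum-tabulate : ∀ {A : Set} {n} (g : Fin n → A) (F : A → ℕ) →
  listSum (map F (tabulate g)) ≡ ∑[ i < n ] F (g i)
listSum-tabulate {n = zero} g F = refl
listSum-tabulate {n = suc n} g F = cong (F (g fzero) +_) (listSum-tabulate (g ∘ fsuc) F)

drop-point : ∀ {n} (P : Fin n → Bool) {y : Fin n} → P y ≡ false → ∀ w → (P w ∧ not (y == w)) ≡ P w
drop-point P {y} Py w with y ≟ w
... | yes refl = trans (∧-zeroʳ (P y)) (sym Py)
... | no _ = ∧-identityʳ (P w)

module StronglyRegularCounting {N} (B : Rel N) {K L M} (B-sym : ∀ i j → B i j ≡ B j i)
  (B-irrefl : ∀ i → B i i ≡ false) (srg : IsStronglyRegular B K L M) where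

  far : Fin N → Fin N → Bool
  far x z = not (B x z) ∧ not (x == z)

  degree≡K : ∀ x → count (B x) ≡ K
  degree≡K x = trans (sym (length-filterᵇ-allFin (B x))) (proj₁ (proj₁ (proj₂ (proj₂ srg))) x)

  count-far : ∀ x → count (far x) ≡ N ∸ K ∸ 1
  count-far x = begin
    count (far x)                                       ≡⟨ cong (_∸ 1) (count-remove x (cong not (B-irrefl x))) ⟨
    count (not ∘ B x) ∸ 1                               ≡⟨ cong (_∸ 1) (m+n∸m≡n (count (B x)) _) ⟨
    count (B x) + count (not ∘ B x) ∸ count (B x) ∸ 1   ≡⟨ cong₂ (λ p q → p ∸ q ∸ 1) (count-complement (B x)) (degree≡K x) ⟩
    N ∸ K ∸ 1                                           ∎

  count-far-from-neighbour : ∀ {x y} → B x y ≡ true → count (λ z → B y z ∧ far x z) ≡ K ∸ L ∸ 1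
  count-far-from-neighbour {x} {y} xy = begin
    count (λ z → B y z ∧ far x z)                                    ≡⟨ count-cong (λ z → ∧-assoc (B y z) _ _) ⟨
    count (λ z → (B y z ∧ not (B x z)) ∧ not (x == z))               ≡⟨ cong (_∸ 1) (count-remove x x-private) ⟨
    count (λ z → B y z ∧ not (B x z)) ∸ 1                            ≡⟨ cong (_∸ 1) (m+n∸m≡n L _) ⟨
    L + count (λ z → B y z ∧ not (B x z)) ∸ L ∸ 1                    ≡⟨ cong (λ c → c + count (λ z → B y z ∧ not (B x z)) ∸ L ∸ 1) common≡L ⟨
    count (λ z → B y z ∧ B x z) + count (λ z → B y z ∧ not (B x z)) ∸ L ∸ 1
                                                                     ≡⟨ cong (λ c → c ∸ L ∸ 1) (count-split (B y) (B x)) ⟨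
    count (B y) ∸ L ∸ 1                                              ≡⟨ cong (λ c → c ∸ L ∸ 1) (degree≡K y) ⟩
    K ∸ L ∸ 1                                                        ∎
    where
    yx : B y x ≡ true
    yx = trans (B-sym y x) xy
    x-private : (B y x ∧ not (B x x)) ≡ true
    x-private rewrite yx | B-irrefl x = refl
    common≡L : count (λ z → B y z ∧ B x z) ≡ L
    common≡L = trans (sym (length-filterᵇ-allFin (λ z → B y z ∧ B x z))) (proj₂ (proj₁ (proj₂ (proj₂ srg))) y x yx)

  count-common-far : ∀ {x z} → far x z ≡ true → count (λ y → B x y ∧ B z y) ≡ M
  count-common-far {x} {z} xz with B x z in bxz | x ≟ z
  ... | false | no x≢z = trans (sym (length-filterᵇ-allFin (λ y → B x y ∧ B z y))) (proj₂ (proj₂ (proj₂ srg)) x z x≢z bxz)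

  -- Both sides count the paths x – y – z with z ∉ N[x].
  srg-identity : Fin N → K * (K ∸ L ∸ 1) ≡ (N ∸ K ∸ 1) * M
  srg-identity x = begin
    K * (K ∸ L ∸ 1)                                                       ≡⟨ cong (_* (K ∸ L ∸ 1)) (degree≡K x) ⟨
    count (B x) * (K ∸ L ∸ 1)                                             ≡⟨ ∑-indicator-const (B x) _ _ (λ y → count-far-from-neighbour) ⟨
    ∑[ y < N ] (⟦ B x y ⟧ * count (λ z → B y z ∧ far x z))                ≡⟨ sum-cong-≗ {N} (λ y → *-distribˡ-sum ⟦ B x y ⟧ (λ z → ⟦ B y z ∧ far x z ⟧)) ⟩
    ∑[ y < N ] ∑[ z < N ] (⟦ B x y ⟧ * ⟦ B y z ∧ far x z ⟧)               ≡⟨ ∑-comm (λ y z → ⟦ B x y ⟧ * ⟦ B y z ∧ far x z ⟧) ⟩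
    ∑[ z < N ] ∑[ y < N ] (⟦ B x y ⟧ * ⟦ B y z ∧ far x z ⟧)               ≡⟨ sum-cong-≗ {N} (λ z → sum-cong-≗ {N} (path z)) ⟩
    ∑[ z < N ] ∑[ y < N ] (⟦ far x z ⟧ * ⟦ B x y ∧ B z y ⟧)               ≡⟨ sum-cong-≗ {N} (λ z → *-distribˡ-sum ⟦ far x z ⟧ (λ y → ⟦ B x y ∧ B z y ⟧)) ⟨
    ∑[ z < N ] (⟦ far x z ⟧ * count (λ y → B x y ∧ B z y))                ≡⟨ ∑-indicator-const (far x) _ _ (λ z → count-common-far) ⟩
    count (far x) * M                                                     ≡⟨ cong (_* M) (count-far x) ⟩
    (N ∸ K ∸ 1) * M                                                       ∎
    where
    path : ∀ z y → ⟦ B x y ⟧ * ⟦ B y z ∧ far x z ⟧ ≡ ⟦ far x z ⟧ * ⟦ B x y ∧ B z y ⟧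
    path z y rewrite ⟦∧⟧ (B y z) (far x z) | ⟦∧⟧ (B x y) (B z y) | B-sym z y = rotate ⟦ B x y ⟧ ⟦ B y z ⟧ ⟦ far x z ⟧
      where
      rotate : ∀ a b c → a * (b * c) ≡ c * (a * b)
      rotate = solve-∀

module Adjacency {n} (G : Graph n) where

  A : Rel n
  A = adj G

  A-sym : ∀ x y → A x y ≡ A y x
  A-sym = Graph.sym G

  adj⇒≢ : ∀ {x y} → A x y ≡ true → x ≢ y
  adj⇒≢ {x} xy refl = contradiction (trans (sym xy) (irrefl G x)) λ ()

  -- Excluding w = x as well as N(x) is what makes gallai-star hold at g = e.
  infix 7 _∉N[_]
  _∉N[_] : Fin n → Fin n → Bool
  w ∉N[ x ] = not (A x w) ∧ not (x == w)

  ∉N-self : ∀ x → (x ∉N[ x ]) ≡ false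
  ∉N-self x rewrite ==-refl x = ∧-zeroʳ (not (A x x))

  ∉N-adj : ∀ {x w} → A x w ≡ true → (w ∉N[ x ]) ≡ false
  ∉N-adj xw rewrite xw = refl

  ∉N-≢ : ∀ {x w} → x ≢ w → (w ∉N[ x ]) ≡ not (A x w)
  ∉N-≢ {x} {w} x≢w rewrite ==-≢ x≢w = ∧-identityʳ (not (A x w))

  ∉N-sym : ∀ x w → (w ∉N[ x ]) ≡ (x ∉N[ w ])
  ∉N-sym x w = cong₂ (λ p q → not p ∧ not q) (A-sym x w) (==-sym x w)

module EdgeRegularλ₁ {n} (G : Graph n) {k} (er : IsEdgeRegular (adj G) k 1) where
  open Adjacency G

  degree≡k : ∀ x → count (A x) ≡ k
  degree≡k x = trans (sym (length-filterᵇ-allFin (A x))) (proj₁ er x)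

  common≡1 : ∀ {x y} → A x y ≡ true → count (λ v → A x v ∧ A y v) ≡ 1
  common≡1 {x} {y} xy = trans (sym (length-filterᵇ-allFin (λ v → A x v ∧ A y v))) (proj₂ er x y xy)

  common-neighbour-unique : ∀ {x y u v} → A x y ≡ true →
    (A x u ∧ A y u) ≡ true → (A x v ∧ A y v) ≡ true → u ≡ v
  common-neighbour-unique {u = u} {v} xy u-common v-common with u ≟ v
  ... | yes u≡v = u≡v
  ... | no u≢v = contradiction (subst (2 ≤_) (common≡1 xy) (count-≥2 u-common v-common u≢v)) λ { (s≤s ()) }

  count-private : ∀ {x y} → A x y ≡ true → count (λ w → A x w ∧ not (A y w)) ≡ k ∸ 1
  count-private {x} {y} xy = begin
    private-count                                      ≡⟨ m+n∸m≡n 1 private-count ⟨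
    1 + private-count ∸ 1                              ≡⟨ cong (λ c → c + private-count ∸ 1) (common≡1 xy) ⟨
    count (λ w → A x w ∧ A y w) + private-count ∸ 1    ≡⟨ cong (_∸ 1) (count-split (A x) (A y)) ⟨
    count (A x) ∸ 1                                    ≡⟨ cong (_∸ 1) (degree≡k x) ⟩
    k ∸ 1                                              ∎
    where
    private-count = count (λ w → A x w ∧ not (A y w))

  count-outside : ∀ {x y} → A x y ≡ true → count (λ w → A x w ∧ w ∉N[ y ]) ≡ k ∸ 2
  count-outside {x} {y} xy = begin
    count (λ w → A x w ∧ w ∉N[ y ])                          ≡⟨ count-cong (λ w → ∧-assoc (A x w) _ _) ⟨
    count (λ w → (A x w ∧ not (A y w)) ∧ not (y == w))       ≡⟨ cong (_∸ 1) (count-remove y y-private) ⟨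
    count (λ w → A x w ∧ not (A y w)) ∸ 1                    ≡⟨ cong (_∸ 1) (count-private xy) ⟩
    k ∸ 1 ∸ 1                                                ≡⟨ ∸-+-assoc k 1 1 ⟩
    k ∸ 2                                                    ∎
    where
    y-private : (A x y ∧ not (A y y)) ≡ true
    y-private rewrite xy | irrefl G y = refl

  k+2≤n : ∀ {x y} → x ≢ y → A x y ≡ false → k + 2 ≤ n
  k+2≤n {x} {y} x≢y xy =
    subst₂ _≤_ (cong (_+ 2) (degree≡k x)) (count-complement (A x))
      (+-monoʳ-≤ (count (A x)) (count-≥2 {P = not ∘ A x} (cong not (irrefl G x)) (cong not xy) x≢y))

  no-diamond : ∀ {x y z w} → A x y ≡ true → A x z ≡ true → y ≢ z →
    A x w ≡ true → A z w ≡ true → A y w ≡ false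
  no-diamond {x} {y} {z} {w} xy xz y≢z xw zw with A y w in yw
  ... | false = refl
  ... | true = contradiction (common-neighbour-unique xw (both xy yw) (both xz zw)) y≢z
    where
    both : ∀ {u} → A x u ≡ true → A u w ≡ true → (A x u ∧ A w u) ≡ true
    both {u} xu uw rewrite xu | A-sym w u | uw = refl

  count-outside-both : ∀ {x y z} → A x y ≡ true → A x z ≡ true → y ≢ z →
    count (λ w → A x w ∧ (not (A y w) ∧ not (A z w))) ≡ k ∸ 2
  count-outside-both {x} {y} {z} xy xz y≢z = begin
    count (λ w → A x w ∧ (not (A y w) ∧ not (A z w)))    ≡⟨ count-cong (λ w → ∧-assoc (A x w) _ _) ⟨
    outside-both                                         ≡⟨ m+n∸m≡n 1 outside-both ⟨
    1 + outside-both ∸ 1                                 ≡⟨ cong (λ c → c + outside-both ∸ 1) (common≡1 xz) ⟨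
    count (λ w → A x w ∧ A z w) + outside-both ∸ 1       ≡⟨ cong (λ c → c + outside-both ∸ 1) (count-cong through-z) ⟨
    count (λ w → (A x w ∧ not (A y w)) ∧ A z w) + outside-both ∸ 1
                                                         ≡⟨ cong (_∸ 1) (count-split (λ w → A x w ∧ not (A y w)) (A z)) ⟨
    count (λ w → A x w ∧ not (A y w)) ∸ 1                ≡⟨ cong (_∸ 1) (count-private xy) ⟩
    k ∸ 1 ∸ 1                                            ≡⟨ ∸-+-assoc k 1 1 ⟩
    k ∸ 2                                                ∎
    where
    outside-both = count (λ w → (A x w ∧ not (A y w)) ∧ not (A z w))
    through-z : ∀ w → ((A x w ∧ not (A y w)) ∧ A z w) ≡ (A x w ∧ A z w)
    through-z w with A x w in xw | A z w in zw
    ... | false | _ = refl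
    ... | true | false = ∧-zeroʳ (not (A y w))
    ... | true | true rewrite no-diamond xy xz y≢z xw zw = refl

  private
    regroup : ∀ a b c d e → (a ∧ ((b ∧ c) ∧ (d ∧ e))) ≡ (((a ∧ (b ∧ d)) ∧ c) ∧ e)
    regroup false b c d e = refl
    regroup true false c d e = refl
    regroup true true c false e = ∧-zeroʳ c
    regroup true true c true e = refl

  count-outside-both-closed-nonadjacent : ∀ {x y z} → A x y ≡ true → A x z ≡ true → y ≢ z → A y z ≡ false →
    count (λ w → A x w ∧ (w ∉N[ y ] ∧ w ∉N[ z ])) ≡ k ∸ 2 ∸ 2
  count-outside-both-closed-nonadjacent {x} {y} {z} xy xz y≢z yz = begin
    count (λ w → A x w ∧ (w ∉N[ y ] ∧ w ∉N[ z ]))                 ≡⟨ count-cong (λ w → regroup (A x w) (not (A y w)) (not (y == w)) (not (A z w)) (not (z == w))) ⟩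
    count (λ w → (outside-yz w ∧ not (y == w)) ∧ not (z == w))             ≡⟨ cong (_∸ 1) (count-remove z z-outside) ⟨
    count (λ w → outside-yz w ∧ not (y == w)) ∸ 1                          ≡⟨ cong (λ c → c ∸ 1 ∸ 1) (count-remove y y-outside) ⟨
    count outside-yz ∸ 1 ∸ 1                                               ≡⟨ cong (λ c → c ∸ 1 ∸ 1) (count-outside-both xy xz y≢z) ⟩
    k ∸ 2 ∸ 1 ∸ 1                                                 ≡⟨ ∸-+-assoc (k ∸ 2) 1 1 ⟩
    k ∸ 2 ∸ 2                                                     ∎
    where
    outside-yz : Fin n → Bool
    outside-yz w = A x w ∧ (not (A y w) ∧ not (A z w))
    y-outside : outside-yz y ≡ true
    y-outside rewrite xy | irrefl G y | A-sym z y | yz = refl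
    z-outside : (outside-yz z ∧ not (y == z)) ≡ true
    z-outside rewrite xz | yz | irrefl G z | ==-≢ y≢z = refl

  count-outside-both-closed-adjacent : ∀ {x y z} → A x y ≡ true → A x z ≡ true → A y z ≡ true →
    count (λ w → A x w ∧ (w ∉N[ y ] ∧ w ∉N[ z ])) ≡ k ∸ 2
  count-outside-both-closed-adjacent {x} {y} {z} xy xz yz = begin
    count (λ w → A x w ∧ (w ∉N[ y ] ∧ w ∉N[ z ]))                 ≡⟨ count-cong (λ w → regroup (A x w) (not (A y w)) (not (y == w)) (not (A z w)) (not (z == w))) ⟩
    count (λ w → (outside-yz w ∧ not (y == w)) ∧ not (z == w))             ≡⟨ count-cong (drop-point (λ w → outside-yz w ∧ not (y == w)) z-outside) ⟩
    count (λ w → outside-yz w ∧ not (y == w))                              ≡⟨ count-cong (drop-point outside-yz y-outside) ⟩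
    count outside-yz                                                       ≡⟨ count-outside-both xy xz (adj⇒≢ yz) ⟩
    k ∸ 2                                                         ∎
    where
    outside-yz : Fin n → Bool
    outside-yz w = A x w ∧ (not (A y w) ∧ not (A z w))
    y-outside : outside-yz y ≡ false
    y-outside rewrite xy | A-sym z y | yz = ∧-zeroʳ (not (A y y))
    z-outside : (outside-yz z ∧ not (y == z)) ≡ false
    z-outside rewrite xz | yz = refl

star : ∀ {n} → Fin n → (Fin n → Bool) → Fin n × Fin n → ℕ
star x P (u , v) = ⟦ (x == u) ∧ P v ⟧ + ⟦ (x == v) ∧ P u ⟧

==∧==-≡ : ∀ {n} {p q r s : Fin n} → ((p == q) ∧ (r == s)) ≡ true → q ≡ p × s ≡ r
==∧==-≡ {p = p} {q} {r} {s} eq with p ≟ q | r ≟ s | eq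
... | yes p≡q | yes r≡s | _ = sym p≡q , sym r≡s

star-sameEdge : ∀ {n} {a b u v : Fin n} → 0 < star a (b ==_) (u , v) → SameEdge u v a b
star-sameEdge {a = a} {b} {u} {v} pos with (a == u) ∧ (b == v) in first
... | true = inj₁ (==∧==-≡ first)
... | false = inj₂ (swap (==∧==-≡ (⟦⟧-pos pos)))

sameEdge-other : ∀ {n} {a b x y z : Fin n} → x ≢ y → SameEdge a b x y → SameEdge a b x z → y ≡ z
sameEdge-other _ (inj₁ (refl , refl)) (inj₁ (refl , refl)) = refl
sameEdge-other x≢y (inj₁ (refl , refl)) (inj₂ (refl , refl)) = contradiction refl x≢y
sameEdge-other x≢y (inj₂ (refl , refl)) (inj₁ (refl , refl)) = contradiction refl x≢y
sameEdge-other _ (inj₂ (refl , refl)) (inj₂ (refl , refl)) = refl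

sameEdge-star : ∀ {n} {a b u v : Fin n} → SameEdge u v a b → 0 < star a (b ==_) (u , v)
sameEdge-star {a = a} {b} (inj₁ (refl , refl)) rewrite ==-refl a | ==-refl b = s≤s z≤n
sameEdge-star {a = a} {b} (inj₂ (refl , refl)) rewrite ==-refl a | ==-refl b = m≤n+m 1 _

∑-star-endpoints : ∀ {n} (u v : Fin n) → ∑[ x < n ] star x (λ _ → true) (u , v) ≡ 2
∑-star-endpoints {n} u v = trans (∑-distrib-+ {n} _ _) (cong₂ _+_ (∑-at u) (∑-at v))
  where
  ∑-at : ∀ w → ∑[ x < n ] ⟦ (x == w) ∧ true ⟧ ≡ 1
  ∑-at w = trans (sum-cong-≗ {n} (λ x → trans (cong ⟦_⟧ (trans (∧-identityʳ (x == w)) (==-sym x w)))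
                                               (sym (*-identityʳ ⟦ w == x ⟧))))
                 (∑-δ w (λ _ → 1))

data Incidence {n} (x : Fin n) : Fin n × Fin n → Set where
  from   : ∀ w → Incidence x (x , w)
  to     : ∀ w → Incidence x (w , x)
  avoids : ∀ {u v} → x ≢ u → x ≢ v → Incidence x (u , v)

incidence : ∀ {n} (x : Fin n) p → Incidence x p
incidence x (u , v) with x ≟ u | x ≟ v
... | yes refl | _ = from v
... | no _ | yes refl = to u
... | no x≢u | no x≢v = avoids x≢u x≢v

star-from : ∀ {n} {x w : Fin n} (P : Fin n → Bool) → x ≢ w → star x P (x , w) ≡ ⟦ P w ⟧
star-from {x = x} {w} P x≢w rewrite ==-refl x | ==-≢ x≢w = +-identityʳ ⟦ P w ⟧

star-to : ∀ {n} {x w : Fin n} (P : Fin n → Bool) → x ≢ w → star x P (w , x) ≡ ⟦ P w ⟧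
star-to {x = x} {w} P x≢w rewrite ==-refl x | ==-≢ x≢w = refl

star-avoids : ∀ {n} {x u v : Fin n} (P : Fin n → Bool) → x ≢ u → x ≢ v → star x P (u , v) ≡ 0
star-avoids P x≢u x≢v rewrite ==-≢ x≢u | ==-≢ x≢v = refl

star-sameEdge-cong : ∀ {n} {x u v a b : Fin n} (P : Fin n → Bool) → SameEdge u v a b →
  star x P (u , v) ≡ star x P (a , b)
star-sameEdge-cong P (inj₁ (refl , refl)) = refl
star-sameEdge-cong {x = x} {a = a} {b} P (inj₂ (refl , refl)) = +-comm ⟦ (x == b) ∧ P a ⟧ ⟦ (x == a) ∧ P b ⟧

star-square : ∀ {n} {x u v : Fin n} (P Q : Fin n → Bool) → u ≢ v →
  star x P (u , v) * star x Q (u , v) ≡ star x (λ w → P w ∧ Q w) (u , v)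
star-square {x = x} {u} {v} P Q u≢v with incidence x (u , v)
... | from w rewrite star-from P u≢v | star-from Q u≢v | star-from (λ w → P w ∧ Q w) u≢v = sym (⟦∧⟧ (P w) (Q w))
... | to w rewrite star-to P (u≢v ∘ sym) | star-to Q (u≢v ∘ sym) | star-to (λ w → P w ∧ Q w) (u≢v ∘ sym) =
  sym (⟦∧⟧ (P w) (Q w))
... | avoids x≢u x≢v rewrite star-avoids P x≢u x≢v | star-avoids (λ w → P w ∧ Q w) x≢u x≢v = refl

star-cross : ∀ {n} {x z u v : Fin n} (P Q : Fin n → Bool) → x ≢ z → u ≢ v → (P z ∧ Q x) ≡ false →
  star x P (u , v) * star z Q (u , v) ≡ 0
star-cross {x = x} {z} {u} {v} P Q x≢z u≢v PzQx with incidence x (u , v)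
star-cross {x = x} {z} P Q x≢z u≢v PzQx | from w with incidence z (x , w)
... | from _ = contradiction refl x≢z
... | to _ rewrite star-from P x≢z | star-to Q (x≢z ∘ sym) = trans (sym (⟦∧⟧ (P z) (Q x))) (cong ⟦_⟧ PzQx)
... | avoids z≢x z≢w rewrite star-avoids Q z≢x z≢w = *-zeroʳ (star x P (x , w))
star-cross {x = x} {z} P Q x≢z u≢v PzQx | to w with incidence z (w , x)
... | from _ rewrite star-to P x≢z | star-from Q (x≢z ∘ sym) = trans (sym (⟦∧⟧ (P z) (Q x))) (cong ⟦_⟧ PzQx)
... | to _ = contradiction refl x≢z
... | avoids z≢w z≢x rewrite star-avoids Q z≢w z≢x = *-zeroʳ (star x P (w , x))
star-cross P Q x≢z u≢v PzQx | avoids x≢u x≢v rewrite star-avoids P x≢u x≢v = refl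

<ᵇ-one-way : ∀ a b → a ≢ b → ⟦ a <ᵇ b ⟧ + ⟦ b <ᵇ a ⟧ ≡ 1
<ᵇ-one-way zero zero a≢b = contradiction refl a≢b
<ᵇ-one-way zero (suc b) _ = refl
<ᵇ-one-way (suc a) zero _ = refl
<ᵇ-one-way (suc a) (suc b) a≢b = <ᵇ-one-way a b (a≢b ∘ cong suc)

module Edges {n} (G : Graph n) where
  open Adjacency G

  m : ℕ
  m = numEdges G

  ends : Fin m → Fin n × Fin n
  ends = edgeAt G

  Joins : Fin m → Fin n → Fin n → Set
  Joins e x y = SameEdge (proj₁ (ends e)) (proj₂ (ends e)) x y

  isEdge : Fin n × Fin n → Bool
  isEdge (u , v) = (toℕ u <ᵇ toℕ v) ∧ A u v

  ends-adj : ∀ e → A (proj₁ (ends e)) (proj₂ (ends e)) ≡ true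
  ends-adj e = Equivalence.to T-≡ (proj₂ (Equivalence.to (T-∧ {toℕ u <ᵇ toℕ v}) listed))
    where
    u = proj₁ (ends e)
    v = proj₂ (ends e)
    listed : T (isEdge (u , v))
    listed = proj₂ (∈-filter⁻ (T? ∘ isEdge) {xs = allPairs n} (∈-lookup {xs = edges G} e))

  ends-proper : ∀ g → proj₁ (ends g) ≢ proj₂ (ends g)
  ends-proper g = adj⇒≢ (ends-adj g)

  ∑-edges : (F : Fin n × Fin n → ℕ) →
    ∑[ e < m ] F (ends e) ≡ ∑[ u < n ] ∑[ v < n ] (⟦ isEdge (u , v) ⟧ * F (u , v))
  ∑-edges F = begin
    ∑[ e < m ] F (ends e)                                          ≡⟨ listSum-lookup (edges G) F ⟩
    listSum (map F (edges G))                                      ≡⟨ listSum-filterᵇ isEdge F (allPairs n) ⟩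
    listSum (map F′ (allPairs n))                                  ≡⟨ listSum-concatMap row F′ (allFin n) ⟩
    listSum (map (λ u → listSum (map F′ (row u))) (allFin n))      ≡⟨ listSum-tabulate (λ u → u) (λ u → listSum (map F′ (row u))) ⟩
    ∑[ u < n ] listSum (map F′ (row u))                            ≡⟨ sum-cong-≗ {n} (λ u → row-sum u) ⟩
    ∑[ u < n ] ∑[ v < n ] F′ (u , v)                               ∎
    where
    F′ : Fin n × Fin n → ℕ
    F′ p = ⟦ isEdge p ⟧ * F p
    row : Fin n → List (Fin n × Fin n)
    row u = map (u ,_) (allFin n)
    row-sum : ∀ u → listSum (map F′ (row u)) ≡ ∑[ v < n ] F′ (u , v)
    row-sum u = trans (cong listSum (sym (map-∘ (allFin n)))) (listSum-tabulate (λ v → v) (λ v → F′ (u , v)))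

  isEdge-orientations : ∀ x w → ⟦ isEdge (x , w) ⟧ + ⟦ isEdge (w , x) ⟧ ≡ ⟦ A x w ⟧
  isEdge-orientations x w rewrite A-sym w x with A x w in xw
  ... | false rewrite ∧-zeroʳ (toℕ x <ᵇ toℕ w) | ∧-zeroʳ (toℕ w <ᵇ toℕ x) = refl
  ... | true rewrite ∧-identityʳ (toℕ x <ᵇ toℕ w) | ∧-identityʳ (toℕ w <ᵇ toℕ x) =
    <ᵇ-one-way (toℕ x) (toℕ w) (adj⇒≢ xw ∘ toℕ-injective)

  ∑-star : ∀ x P → ∑[ e < m ] star x P (ends e) ≡ count (λ w → A x w ∧ P w)
  ∑-star x P = begin
    ∑[ e < m ] star x P (ends e)                                                  ≡⟨ ∑-edges (star x P) ⟩
    ∑[ u < n ] ∑[ v < n ] (I u v * star x P (u , v))                              ≡⟨ sum-cong-≗ {n} (λ u → trans (sum-cong-≗ {n} (split u)) (∑-distrib-+ {n} _ _)) ⟩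
    ∑[ u < n ] (∑[ v < n ] (⟦ x == u ⟧ * (I u v * p v)) + ∑[ v < n ] (⟦ x == v ⟧ * (I u v * p u)))
                                                                                  ≡⟨ ∑-distrib-+ {n} _ _ ⟩
    ∑[ u < n ] ∑[ v < n ] (⟦ x == u ⟧ * (I u v * p v)) + ∑[ u < n ] ∑[ v < n ] (⟦ x == v ⟧ * (I u v * p u))
                                                                                  ≡⟨ cong₂ _+_ from-x to-x ⟩
    ∑[ w < n ] (I x w * p w) + ∑[ w < n ] (I w x * p w)                           ≡⟨ ∑-distrib-+ {n} _ _ ⟨
    ∑[ w < n ] (I x w * p w + I w x * p w)                                        ≡⟨ sum-cong-≗ {n} either-way ⟩
    count (λ w → A x w ∧ P w)                                                     ∎
    where
    I : Fin n → Fin n → ℕ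
    I u v = ⟦ isEdge (u , v) ⟧
    p : Fin n → ℕ
    p w = ⟦ P w ⟧
    split : ∀ u v → I u v * star x P (u , v) ≡ ⟦ x == u ⟧ * (I u v * p v) + ⟦ x == v ⟧ * (I u v * p u)
    split u v rewrite ⟦∧⟧ (x == u) (P v) | ⟦∧⟧ (x == v) (P u) = distribute (I u v) ⟦ x == u ⟧ (p v) ⟦ x == v ⟧ (p u)
      where
      distribute : ∀ a b c d e → a * (b * c + d * e) ≡ b * (a * c) + d * (a * e)
      distribute = solve-∀
    from-x : ∑[ u < n ] ∑[ v < n ] (⟦ x == u ⟧ * (I u v * p v)) ≡ ∑[ w < n ] (I x w * p w)
    from-x = trans (sum-cong-≗ {n} (λ u → sym (*-distribˡ-sum ⟦ x == u ⟧ (λ v → I u v * p v))))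
                   (∑-δ x (λ u → ∑[ v < n ] (I u v * p v)))
    to-x : ∑[ u < n ] ∑[ v < n ] (⟦ x == v ⟧ * (I u v * p u)) ≡ ∑[ w < n ] (I w x * p w)
    to-x = sum-cong-≗ {n} (λ u → ∑-δ x (λ v → I u v * p u))
    either-way : ∀ w → I x w * p w + I w x * p w ≡ ⟦ A x w ∧ P w ⟧
    either-way w = begin
      I x w * p w + I w x * p w     ≡⟨ *-distribʳ-+ (p w) (I x w) (I w x) ⟨
      (I x w + I w x) * p w         ≡⟨ cong (_* p w) (isEdge-orientations x w) ⟩
      ⟦ A x w ⟧ * p w               ≡⟨ ⟦∧⟧ (A x w) (P w) ⟨
      ⟦ A x w ∧ P w ⟧               ∎

  ends-joins : ∀ e → Joins e (proj₁ (ends e)) (proj₂ (ends e))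
  ends-joins e = inj₁ (refl , refl)

  joins-adj : ∀ {e x y} → Joins e x y → A x y ≡ true
  joins-adj {e} (inj₁ (refl , refl)) = ends-adj e
  joins-adj {e} {x} {y} (inj₂ (refl , refl)) = trans (A-sym x y) (ends-adj e)

  ∑-star-sameEdge : ∀ a b → ∑[ e < m ] star a (b ==_) (ends e) ≡ ⟦ A a b ⟧
  ∑-star-sameEdge a b = begin
    ∑[ e < m ] star a (b ==_) (ends e)    ≡⟨ ∑-star a (b ==_) ⟩
    count (λ w → A a w ∧ (b == w))        ≡⟨ sum-cong-≗ {n} (λ w → trans (cong ⟦_⟧ (∧-comm (A a w) (b == w))) (⟦∧⟧ (b == w) (A a w))) ⟩
    ∑[ w < n ] (⟦ b == w ⟧ * ⟦ A a w ⟧)    ≡⟨ ∑-δ b (λ w → ⟦ A a w ⟧) ⟩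
    ⟦ A a b ⟧                             ∎

  joins-surjective : ∀ {a b} → A a b ≡ true → ∃[ e ] Joins e a b
  joins-surjective {a} {b} ab with ∑-witness (λ e → star a (b ==_) (ends e)) listed
    where
    listed : 0 < ∑[ e < m ] star a (b ==_) (ends e)
    listed rewrite ∑-star-sameEdge a b | ab = s≤s z≤n
  ... | e , pos = e , star-sameEdge pos

  joins-injective : ∀ {e f x y} → Joins e x y → Joins f x y → e ≡ f
  joins-injective {e} {f} {x} {y} je jf with e ≟ f
  ... | yes e≡f = e≡f
  ... | no e≢f = contradiction (subst (2 ≤_) (∑-star-sameEdge x y) twice) (at-most-once (A x y))
    where
    twice : 2 ≤ ∑[ g < m ] star x (y ==_) (ends g)
    twice = ∑-≥2 (λ g → star x (y ==_) (ends g)) (sameEdge-star je) (sameEdge-star jf) e≢f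
    at-most-once : ∀ b → ¬ (2 ≤ ⟦ b ⟧)
    at-most-once true (s≤s ())

  handshake : ∀ {k} → (∀ x → count (A x) ≡ k) → 2 * m ≡ n * k
  handshake {k} degree = begin
    2 * m                                                   ≡⟨ *-comm 2 m ⟩
    m * 2                                                   ≡⟨ ∑-const m 2 ⟨
    ∑[ e < m ] 2                                            ≡⟨ sum-cong-≗ {m} (λ e → ∑-star-endpoints (proj₁ (ends e)) (proj₂ (ends e))) ⟨
    ∑[ e < m ] ∑[ x < n ] star x (λ _ → true) (ends e)      ≡⟨ ∑-comm (λ e x → star x (λ _ → true) (ends e)) ⟩
    ∑[ x < n ] ∑[ e < m ] star x (λ _ → true) (ends e)      ≡⟨ sum-cong-≗ {n} (λ x → ∑-star x (λ _ → true)) ⟩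
    ∑[ x < n ] count (λ w → A x w ∧ true)                   ≡⟨ sum-cong-≗ {n} (λ x → trans (count-cong (λ w → ∧-identityʳ (A x w))) (degree x)) ⟩
    ∑[ x < n ] k                                            ≡⟨ ∑-const n k ⟩
    n * k                                                   ∎

module Gallai {n} (G : Graph n) where
  open Adjacency G
  open Edges G

  gallaiPair-at₁₁ : ∀ a b w → gallaiPair G (a , b) (a , w) ≡ not (A b w)
  gallaiPair-at₁₁ a b w rewrite ==-refl a = refl

  gallaiPair-at₁₂ : ∀ {a b w} → a ≢ w → gallaiPair G (a , b) (w , a) ≡ not (A b w)
  gallaiPair-at₁₂ {a} a≢w rewrite ==-≢ a≢w | ==-refl a = refl

  gallaiPair-at₂₁ : ∀ {a b w} → a ≢ b → a ≢ w → gallaiPair G (a , b) (b , w) ≡ not (A a w)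
  gallaiPair-at₂₁ {b = b} a≢b a≢w rewrite ==-≢ a≢b | ==-≢ a≢w | ==-refl b = refl

  gallaiPair-at₂₂ : ∀ {a b w} → a ≢ w → a ≢ b → b ≢ w → gallaiPair G (a , b) (w , b) ≡ not (A a w)
  gallaiPair-at₂₂ {b = b} a≢w a≢b b≢w rewrite ==-≢ a≢w | ==-≢ a≢b | ==-≢ b≢w | ==-refl b = refl

  gallaiPair-disjoint : ∀ {a b u v} → a ≢ u → a ≢ v → b ≢ u → b ≢ v → gallaiPair G (a , b) (u , v) ≡ false
  gallaiPair-disjoint a≢u a≢v b≢u b≢v rewrite ==-≢ a≢u | ==-≢ a≢v | ==-≢ b≢u | ==-≢ b≢v = refl

  gallaiPair-star : ∀ {a b u v} → a ≢ b → u ≢ v → ¬ SameEdge u v a b →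
    ⟦ gallaiPair G (a , b) (u , v) ⟧ ≡ star a (_∉N[ b ]) (u , v) + star b (_∉N[ a ]) (u , v)
  gallaiPair-star {a} {b} {u} {v} a≢b u≢v other with incidence a (u , v)
  ... | from w = begin
    ⟦ gallaiPair G (a , b) (a , w) ⟧                    ≡⟨ cong ⟦_⟧ (trans (gallaiPair-at₁₁ a b w) (sym (∉N-≢ b≢w))) ⟩
    ⟦ w ∉N[ b ] ⟧                                       ≡⟨ +-identityʳ _ ⟨
    ⟦ w ∉N[ b ] ⟧ + 0                                   ≡⟨ cong₂ _+_ (star-from (_∉N[ b ]) u≢v) (star-avoids (_∉N[ a ]) (a≢b ∘ sym) b≢w) ⟨
    star a (_∉N[ b ]) (a , w) + star b (_∉N[ a ]) (a , w) ∎
    where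
    b≢w : b ≢ w
    b≢w b≡w = other (inj₁ (refl , sym b≡w))
  ... | to w = begin
    ⟦ gallaiPair G (a , b) (w , a) ⟧                    ≡⟨ cong ⟦_⟧ (trans (gallaiPair-at₁₂ (u≢v ∘ sym)) (sym (∉N-≢ b≢w))) ⟩
    ⟦ w ∉N[ b ] ⟧                                       ≡⟨ +-identityʳ _ ⟨
    ⟦ w ∉N[ b ] ⟧ + 0                                   ≡⟨ cong₂ _+_ (star-to (_∉N[ b ]) (u≢v ∘ sym)) (star-avoids (_∉N[ a ]) b≢w (a≢b ∘ sym)) ⟨
    star a (_∉N[ b ]) (w , a) + star b (_∉N[ a ]) (w , a) ∎
    where
    b≢w : b ≢ w
    b≢w b≡w = other (inj₂ (sym b≡w , refl))
  ... | avoids a≢u a≢v with incidence b (u , v)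
  ...   | from w = begin
    ⟦ gallaiPair G (a , b) (b , w) ⟧                    ≡⟨ cong ⟦_⟧ (trans (gallaiPair-at₂₁ a≢b a≢v) (sym (∉N-≢ a≢v))) ⟩
    ⟦ w ∉N[ a ] ⟧                                       ≡⟨ cong₂ _+_ (star-avoids (_∉N[ b ]) a≢u a≢v) (star-from (_∉N[ a ]) u≢v) ⟨
    star a (_∉N[ b ]) (b , w) + star b (_∉N[ a ]) (b , w) ∎
  ...   | to w = begin
    ⟦ gallaiPair G (a , b) (w , b) ⟧                    ≡⟨ cong ⟦_⟧ (trans (gallaiPair-at₂₂ a≢u a≢b (u≢v ∘ sym)) (sym (∉N-≢ a≢u))) ⟩
    ⟦ w ∉N[ a ] ⟧                                       ≡⟨ cong₂ _+_ (star-avoids (_∉N[ b ]) a≢u a≢v) (star-to (_∉N[ a ]) (u≢v ∘ sym)) ⟨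
    star a (_∉N[ b ]) (w , b) + star b (_∉N[ a ]) (w , b) ∎
  ...   | avoids b≢u b≢v = begin
    ⟦ gallaiPair G (a , b) (u , v) ⟧                    ≡⟨ cong ⟦_⟧ (gallaiPair-disjoint a≢u a≢v b≢u b≢v) ⟩
    0                                                   ≡⟨ cong₂ _+_ (star-avoids (_∉N[ b ]) a≢u a≢v) (star-avoids (_∉N[ a ]) b≢u b≢v) ⟨
    star a (_∉N[ b ]) (u , v) + star b (_∉N[ a ]) (u , v) ∎

  gallai-self : ∀ e → gallai G e e ≡ false
  gallai-self e = cong (λ b → not b ∧ gallaiPair G (ends e) (ends e)) (==-refl e)

  gallai-distinct : ∀ {e g} → e ≢ g → gallai G e g ≡ gallaiPair G (ends e) (ends g)
  gallai-distinct {e} {g} e≢g = cong (λ b → not b ∧ gallaiPair G (ends e) (ends g)) (==-≢ e≢g)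

  gallaiPair-ends-star : ∀ {e g x y} → Joins e x y → e ≢ g →
    ⟦ gallaiPair G (ends e) (ends g) ⟧ ≡ star x (_∉N[ y ]) (ends g) + star y (_∉N[ x ]) (ends g)
  gallaiPair-ends-star {e} {g} (inj₁ (refl , refl)) e≢g =
    gallaiPair-star (ends-proper e) (ends-proper g) (e≢g ∘ joins-injective (ends-joins e))
  gallaiPair-ends-star {e} {g} {x} {y} (inj₂ (refl , refl)) e≢g =
    trans (gallaiPair-star (ends-proper e) (ends-proper g) (e≢g ∘ joins-injective (ends-joins e)))
          (+-comm (star y (_∉N[ x ]) (ends g)) (star x (_∉N[ y ]) (ends g)))

  gallai-star : ∀ {e x y} → Joins e x y → ∀ g →
    ⟦ gallai G e g ⟧ ≡ star x (_∉N[ y ]) (ends g) + star y (_∉N[ x ]) (ends g)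
  gallai-star {e} {x} {y} j g = by-cases (e ≟ g)
    where
    x≢y : x ≢ y
    x≢y = adj⇒≢ (joins-adj j)
    by-cases : Dec (e ≡ g) → ⟦ gallai G e g ⟧ ≡ star x (_∉N[ y ]) (ends g) + star y (_∉N[ x ]) (ends g)
    by-cases (no e≢g) = trans (cong ⟦_⟧ (gallai-distinct e≢g)) (gallaiPair-ends-star j e≢g)
    by-cases (yes refl) = begin
      ⟦ gallai G e e ⟧                                        ≡⟨ cong ⟦_⟧ (gallai-self e) ⟩
      0                                                       ≡⟨ cong₂ (λ p q → ⟦ p ⟧ + ⟦ q ⟧) (∉N-self y) (∉N-self x) ⟨
      ⟦ y ∉N[ y ] ⟧ + ⟦ x ∉N[ x ] ⟧                           ≡⟨ cong₂ _+_ (star-from (_∉N[ y ]) x≢y) (star-to (_∉N[ x ]) (x≢y ∘ sym)) ⟨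
      star x (_∉N[ y ]) (x , y) + star y (_∉N[ x ]) (x , y)   ≡⟨ cong₂ _+_ (star-sameEdge-cong {x = x} (_∉N[ y ]) j) (star-sameEdge-cong {x = y} (_∉N[ x ]) j) ⟨
      star x (_∉N[ y ]) (ends e) + star y (_∉N[ x ]) (ends e) ∎

  star-pair-sym : ∀ a b c d →
    star a (_∉N[ b ]) (c , d) + star b (_∉N[ a ]) (c , d) ≡ star c (_∉N[ d ]) (a , b) + star d (_∉N[ c ]) (a , b)
  star-pair-sym a b c d = begin
    (t a c d b + t a d c b) + (t b c d a + t b d c a)
      ≡⟨ cong₂ _+_ (cong₂ _+_ (flip-term a c d b) (flip-term a d c b)) (cong₂ _+_ (flip-term b c d a) (flip-term b d c a)) ⟩
    (t c a b d + t d a b c) + (t c b a d + t d b a c)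
      ≡⟨ middle-swap (t c a b d) (t d a b c) (t c b a d) (t d b a c) ⟩
    (t c a b d + t c b a d) + (t d a b c + t d b a c) ∎
    where
    t : Fin n → Fin n → Fin n → Fin n → ℕ
    t p q r s = ⟦ (p == q) ∧ r ∉N[ s ] ⟧
    flip-term : ∀ p q r s → t p q r s ≡ t q p s r
    flip-term p q r s = cong₂ (λ i o → ⟦ i ∧ o ⟧) (==-sym p q) (∉N-sym s r)
    middle-swap : ∀ i j o l → (i + j) + (o + l) ≡ (i + o) + (j + l)
    middle-swap = solve-∀

  gallai-sym : ∀ e g → gallai G e g ≡ gallai G g e
  gallai-sym e g = ⟦⟧-injective (begin
    ⟦ gallai G e g ⟧                                                    ≡⟨ gallai-star (ends-joins e) g ⟩
    star a (_∉N[ b ]) (c , d) + star b (_∉N[ a ]) (c , d)               ≡⟨ star-pair-sym a b c d ⟩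
    star c (_∉N[ d ]) (a , b) + star d (_∉N[ c ]) (a , b)               ≡⟨ gallai-star (ends-joins g) e ⟨
    ⟦ gallai G g e ⟧                                                    ∎)
    where
    a = proj₁ (ends e)
    b = proj₂ (ends e)
    c = proj₁ (ends g)
    d = proj₂ (ends g)

  gallai-common-star : ∀ {e f x y z} → Joins e x y → Joins f x z → y ≢ z → ∀ g →
    ⟦ gallai G e g ∧ gallai G f g ⟧ ≡ star x (λ w → w ∉N[ y ] ∧ w ∉N[ z ]) (ends g)
  gallai-common-star {e} {f} {x} {y} {z} je jf y≢z g = begin
    ⟦ gallai G e g ∧ gallai G f g ⟧                     ≡⟨ ⟦∧⟧ (gallai G e g) (gallai G f g) ⟩
    ⟦ gallai G e g ⟧ * ⟦ gallai G f g ⟧                 ≡⟨ cong₂ _*_ (gallai-star je g) (gallai-star jf g) ⟩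
    (Xy + Yx) * (Xz + Zx)                               ≡⟨ expand Xy Yx Xz Zx ⟩
    Xy * Xz + (Xy * Zx + (Yx * Xz + Yx * Zx))           ≡⟨ cong₂ _+_ (star-square {x = x} (_∉N[ y ]) (_∉N[ z ]) proper) vanish ⟩
    star x (λ w → w ∉N[ y ] ∧ w ∉N[ z ]) (ends g) + 0   ≡⟨ +-identityʳ _ ⟩
    star x (λ w → w ∉N[ y ] ∧ w ∉N[ z ]) (ends g)       ∎
    where
    Xy = star x (_∉N[ y ]) (ends g)
    Yx = star y (_∉N[ x ]) (ends g)
    Xz = star x (_∉N[ z ]) (ends g)
    Zx = star z (_∉N[ x ]) (ends g)
    proper = ends-proper g
    x≢y : x ≢ y
    x≢y = adj⇒≢ (joins-adj je)
    x≢z : x ≢ z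
    x≢z = adj⇒≢ (joins-adj jf)
    expand : ∀ a b c d → (a + b) * (c + d) ≡ a * c + (a * d + (b * c + b * d))
    expand = solve-∀
    vanish : Xy * Zx + (Yx * Xz + Yx * Zx) ≡ 0
    vanish = cong₂ _+_ (star-cross (_∉N[ y ]) (_∉N[ x ]) x≢z proper (trans (cong (z ∉N[ y ] ∧_) (∉N-self x)) (∧-zeroʳ _)))
              (cong₂ _+_ (star-cross (_∉N[ x ]) (_∉N[ z ]) (x≢y ∘ sym) proper (cong (_∧ y ∉N[ z ]) (∉N-self x)))
                         (star-cross (_∉N[ x ]) (_∉N[ x ]) y≢z proper (cong (_∧ y ∉N[ x ]) (∉N-adj (joins-adj jf)))))

  gallaiPair-shares : ∀ {a b c d} → gallaiPair G (a , b) (c , d) ≡ true →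
    ∃[ x ] ∃[ y ] ∃[ z ] (SameEdge a b x y × SameEdge c d x z × A y z ≡ false)
  gallaiPair-shares {a} {b} {c} {d} gp with a ≟ c | gp
  ... | yes refl | gp₁ = a , b , d , inj₁ (refl , refl) , inj₁ (refl , refl) , not-true gp₁
  ... | no _ | gp₁ with a ≟ d | gp₁
  ...   | yes refl | gp₂ = a , b , c , inj₁ (refl , refl) , inj₂ (refl , refl) , not-true gp₂
  ...   | no _ | gp₂ with b ≟ c | gp₂
  ...     | yes refl | gp₃ = b , a , d , inj₂ (refl , refl) , inj₁ (refl , refl) , not-true gp₃
  ...     | no _ | gp₃ with b ≟ d | gp₃
  ...       | yes refl | gp₄ = b , a , c , inj₂ (refl , refl) , inj₂ (refl , refl) , not-true gp₄

  gallai-adjacent : ∀ {e f} → gallai G e f ≡ true →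
    ∃[ x ] ∃[ y ] ∃[ z ] (Joins e x y × Joins f x z × y ≢ z × A y z ≡ false)
  gallai-adjacent {e} {f} ef = by-cases (e ≟ f)
    where
    by-cases : Dec (e ≡ f) → ∃[ x ] ∃[ y ] ∃[ z ] (Joins e x y × Joins f x z × y ≢ z × A y z ≡ false)
    by-cases (yes refl) = contradiction (trans (sym ef) (gallai-self e)) λ ()
    by-cases (no e≢f) with gallaiPair-shares (trans (sym (gallai-distinct e≢f)) ef)
    ... | x , y , z , je , jf , yz = x , y , z , je , jf , (λ { refl → e≢f (joins-injective je jf) }) , yz

  gallai-degree : ∀ e → count (gallai G e) ≡
    count (λ w → A (proj₁ (ends e)) w ∧ w ∉N[ proj₂ (ends e) ]) + count (λ w → A (proj₂ (ends e)) w ∧ w ∉N[ proj₁ (ends e) ])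
  gallai-degree e = begin
    count (gallai G e)                                            ≡⟨ sum-cong-≗ {m} (gallai-star (ends-joins e)) ⟩
    ∑[ g < m ] (star a (_∉N[ b ]) (ends g) + star b (_∉N[ a ]) (ends g))
                                                                  ≡⟨ ∑-distrib-+ {m} _ _ ⟩
    ∑[ g < m ] star a (_∉N[ b ]) (ends g) + ∑[ g < m ] star b (_∉N[ a ]) (ends g)
                                                                  ≡⟨ cong₂ _+_ (∑-star a (_∉N[ b ])) (∑-star b (_∉N[ a ])) ⟩
    count (λ w → A a w ∧ w ∉N[ b ]) + count (λ w → A b w ∧ w ∉N[ a ]) ∎
    where
    a = proj₁ (ends e)
    b = proj₂ (ends e)

  gallai-common : ∀ {e f x y z} → Joins e x y → Joins f x z → y ≢ z →
    count (λ g → gallai G e g ∧ gallai G f g) ≡ count (λ w → A x w ∧ (w ∉N[ y ] ∧ w ∉N[ z ]))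
  gallai-common {x = x} {y} {z} je jf y≢z =
    trans (sum-cong-≗ {m} (gallai-common-star je jf y≢z)) (∑-star x (λ w → w ∉N[ y ] ∧ w ∉N[ z ]))

m∸n≡suc⇒m≡suc+n : ∀ m c {d} → m ∸ c ≡ suc d → m ≡ suc d + c
m∸n≡suc⇒m≡suc+n m c eq = trans (sym (m∸n+n≡m {m} {c} (<⇒≤ (m∸n≢0⇒n<m λ m∸c≡0 → contradiction (trans (sym eq) m∸c≡0) λ ()))))
                      (cong (_+ c) eq)

gallai-parameters-infeasible : ∀ {k m n} → 3 ≤ k → 2 * m ≡ n * k → k + 2 ≤ n →
  2 * (k ∸ 2) * (2 * (k ∸ 2) ∸ (k ∸ 2 ∸ 2) ∸ 1) ≢ (m ∸ 2 * (k ∸ 2) ∸ 1) * (k ∸ 2)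
gallai-parameters-infeasible {suc (suc zero)} (s≤s (s≤s ()))
gallai-parameters-infeasible {3} {m} _ handshake n≥5 eq =
  -- For k = 3 the truncated λ′ = k ∸ 2 ∸ 2 is 0 rather than k − 4, and the identity gives m = 5.
  from-no (15 ≤? 10) (≤-trans (*-monoˡ-≤ 3 n≥5) (≤-reflexive (trans (sym handshake) (cong (2 *_) m≡5))))
  where
  m≡5 : m ≡ 5
  m≡5 = m∸n≡suc⇒m≡suc+n m 3 (trans (sym (∸-+-assoc m 2 1)) (trans (sym (*-identityʳ _)) (sym eq)))
gallai-parameters-infeasible {suc (suc (suc (suc i)))} {m} {n} _ handshake n≥k+2 eq =
  m+1+n≰m (22 + 8 * i) (≤-trans lower (≤-reflexive upper))
  where
  K = 2 * (2 + i)
  outside : K ∸ i ∸ 1 ≡ 3 + i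
  outside = trans (cong (λ c → c ∸ i ∸ 1) (K≡ i)) (cong (_∸ 1) (m+n∸m≡n i (4 + i)))
    where
    K≡ : ∀ i → 2 * (2 + i) ≡ i + (4 + i)
    K≡ = solve-∀
  R≡ : m ∸ K ∸ 1 ≡ 2 * (3 + i)
  R≡ = *-cancelʳ-≡ (m ∸ K ∸ 1) (2 * (3 + i)) (2 + i) (trans (sym eq) (trans (cong (K *_) outside) (regroup i)))
    where
    regroup : ∀ i → 2 * (2 + i) * (3 + i) ≡ 2 * (3 + i) * (2 + i)
    regroup = solve-∀
  m≡11+4i : m ≡ 11 + 4 * i
  m≡11+4i = trans (m∸n≡suc⇒m≡suc+n m (K + 1) (trans (sym (∸-+-assoc m K 1)) R≡)) (total i)
    where
    total : ∀ i → 2 * (3 + i) + (2 * (2 + i) + 1) ≡ 11 + 4 * i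
    total = solve-∀
  lower : 22 + 8 * i + suc (1 + 2 * i + i * i) ≤ n * (4 + i)
  lower = ≤-trans (≤-reflexive (expand i)) (*-monoˡ-≤ (4 + i) n≥k+2)
    where
    expand : ∀ i → 22 + 8 * i + suc (1 + 2 * i + i * i) ≡ (4 + i + 2) * (4 + i)
    expand = solve-∀
  upper : n * (4 + i) ≡ 22 + 8 * i
  upper = trans (sym handshake) (trans (cong (2 *_) m≡11+4i) (double i))
    where
    double : ∀ i → 2 * (11 + 4 * i) ≡ 22 + 8 * i
    double = solve-∀

module GallaiOfEdgeRegularλ₁ {n} (G : Graph n) {k} (er : IsEdgeRegular (adj G) k 1) where
  open Adjacency G
  open EdgeRegularλ₁ G er
  open Edges G
  open Gallai G

  gallai-degree≡ : ∀ e → count (gallai G e) ≡ 2 * (k ∸ 2)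
  gallai-degree≡ e =
    trans (gallai-degree e)
      (trans (cong₂ _+_ (count-outside (ends-adj e)) (count-outside (trans (A-sym (proj₂ (ends e)) (proj₁ (ends e))) (ends-adj e))))
             (cong ((k ∸ 2) +_) (sym (+-identityʳ (k ∸ 2)))))

  gallai-common-adjacent : ∀ {e f} → gallai G e f ≡ true → count (λ g → gallai G e g ∧ gallai G f g) ≡ k ∸ 2 ∸ 2
  gallai-common-adjacent ef with gallai-adjacent ef
  ... | x , y , z , je , jf , y≢z , yz =
    trans (gallai-common je jf y≢z) (count-outside-both-closed-nonadjacent (joins-adj je) (joins-adj jf) y≢z yz)

  gallai-isEdgeRegular : IsEdgeRegular (gallai G) (2 * (k ∸ 2)) (k ∸ 2 ∸ 2)
  gallai-isEdgeRegular =
    (λ e → trans (length-filterᵇ-allFin (gallai G e)) (gallai-degree≡ e)) ,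
    (λ e f ef → trans (length-filterᵇ-allFin (λ g → gallai G e g ∧ gallai G f g)) (gallai-common-adjacent ef))

  triangle-edges : ∀ {x y} → A x y ≡ true →
    ∃[ e ] ∃[ f ] (e ≢ f × gallai G e f ≡ false × count (λ g → gallai G e g ∧ gallai G f g) ≡ k ∸ 2)
  triangle-edges {x} {y} xy with count-witness (λ v → A x v ∧ A y v) (subst (0 <_) (sym (common≡1 xy)) (s≤s z≤n))
  ... | t , xt∧yt with ∧-true xt∧yt
  ...   | xt , yt with joins-surjective xy | joins-surjective xt
  ...     | e , je | f , jf = e , f , e≢f , ⟦⟧-injective not-adjacent ,
                               trans (gallai-common je jf y≢t) (count-outside-both-closed-adjacent xy xt yt)
    where
    y≢t = adj⇒≢ yt
    e≢f : e ≢ f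
    e≢f refl = y≢t (sameEdge-other (adj⇒≢ xy) je jf)
    not-adjacent : ⟦ gallai G e f ⟧ ≡ 0
    not-adjacent = begin
      ⟦ gallai G e f ⟧                                        ≡⟨ gallai-star je f ⟩
      star x (_∉N[ y ]) (ends f) + star y (_∉N[ x ]) (ends f) ≡⟨ cong₂ _+_ (star-sameEdge-cong {x = x} (_∉N[ y ]) jf) (star-sameEdge-cong {x = y} (_∉N[ x ]) jf) ⟩
      star x (_∉N[ y ]) (x , t) + star y (_∉N[ x ]) (x , t)   ≡⟨ cong₂ _+_ (star-from (_∉N[ y ]) (adj⇒≢ xt)) (star-avoids (_∉N[ x ]) (adj⇒≢ xy ∘ sym) y≢t) ⟩
      ⟦ t ∉N[ y ] ⟧ + 0                                       ≡⟨ cong (λ p → ⟦ p ⟧ + 0) (∉N-adj yt) ⟩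
      0                                                       ∎

  gallai-not-stronglyRegular : 3 ≤ k → NotComplete A → NotEmpty A → ¬ StronglyRegular (gallai G)
  gallai-not-stronglyRegular k≥3 (x , y , x≢y , xy) (a , b , ab) (K , L , M , srgΓ) =
    infeasible K≡ L≡ M≡ (srg-identity e₀)
    where
    open StronglyRegularCounting (gallai G) gallai-sym gallai-self srgΓ using (degree≡K; srg-identity)
    e₀ = proj₁ (proj₁ (proj₂ srgΓ))
    f₀ = proj₁ (proj₂ (proj₁ (proj₂ srgΓ)))
    e₀f₀ = proj₂ (proj₂ (proj₁ (proj₂ srgΓ)))
    K≡ : K ≡ 2 * (k ∸ 2)
    K≡ = trans (sym (degree≡K e₀)) (gallai-degree≡ e₀)
    L≡ : L ≡ k ∸ 2 ∸ 2
    L≡ = trans (sym (proj₂ (proj₁ (proj₂ (proj₂ srgΓ))) e₀ f₀ e₀f₀))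
               (trans (length-filterᵇ-allFin (λ g → gallai G e₀ g ∧ gallai G f₀ g)) (gallai-common-adjacent e₀f₀))
    M≡ : M ≡ k ∸ 2
    M≡ = let e , f , e≢f , ef , common≡k-2 = triangle-edges ab in
      trans (sym (proj₂ (proj₂ (proj₂ srgΓ)) e f e≢f ef))
            (trans (length-filterᵇ-allFin (λ g → gallai G e g ∧ gallai G f g)) common≡k-2)
    infeasible : ∀ {K L M} → K ≡ 2 * (k ∸ 2) → L ≡ k ∸ 2 ∸ 2 → M ≡ k ∸ 2 → K * (K ∸ L ∸ 1) ≢ (m ∸ K ∸ 1) * M
    infeasible refl refl refl = gallai-parameters-infeasible k≥3 (handshake degree≡k) (k+2≤n x≢y xy)

module FourCycles {n} (G : Graph n) where
  open Adjacency G

  Cycle : Set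
  Cycle = Fin n × Fin n × Fin n × Fin n

  first : Cycle → Fin n
  first (v₀ , _ , _ , _) = v₀

  rotate : Cycle → Cycle
  rotate (v₀ , v₁ , v₂ , v₃) = v₁ , v₂ , v₃ , v₀

  rotations : ℕ → Cycle → Cycle
  rotations zero C = C
  rotations (suc i) C = rotations i (rotate C)

  Closed : Cycle → Set
  Closed (v₀ , v₁ , v₂ , v₃) = A v₀ v₁ ≡ true × A v₁ v₂ ≡ true × A v₂ v₃ ≡ true × A v₃ v₀ ≡ true

  closed-rotations : ∀ i {C} → Closed C → Closed (rotations i C)
  closed-rotations zero c = c
  closed-rotations (suc i) (c₀₁ , c₁₂ , c₂₃ , c₃₀) = closed-rotations i (c₁₂ , c₂₃ , c₃₀ , c₀₁)

  onCycle-rotations : ∀ i {C a b} → OnCycle a b C → OnCycle a b (rotations i C)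
  onCycle-rotations zero e = e
  onCycle-rotations (suc i) e = onCycle-rotations i (shift e)
    where
    shift : ∀ {C a b} → OnCycle a b C → OnCycle a b (rotate C)
    shift (inj₁ s) = inj₂ (inj₂ (inj₂ s))
    shift (inj₂ (inj₁ s)) = inj₁ s
    shift (inj₂ (inj₂ (inj₁ s))) = inj₂ (inj₁ s)
    shift (inj₂ (inj₂ (inj₂ s))) = inj₂ (inj₂ (inj₁ s))

  onCycle-position : ∀ {C x a} → OnCycle x a C → ∃[ i ] x ≡ first (rotations i C)
  onCycle-position (inj₁ (inj₁ (refl , _))) = 0 , refl
  onCycle-position (inj₁ (inj₂ (refl , _))) = 1 , refl
  onCycle-position (inj₂ (inj₁ (inj₁ (refl , _)))) = 1 , refl
  onCycle-position (inj₂ (inj₁ (inj₂ (refl , _)))) = 2 , refl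
  onCycle-position (inj₂ (inj₂ (inj₁ (inj₁ (refl , _))))) = 2 , refl
  onCycle-position (inj₂ (inj₂ (inj₁ (inj₂ (refl , _))))) = 3 , refl
  onCycle-position (inj₂ (inj₂ (inj₂ (inj₁ (refl , _))))) = 3 , refl
  onCycle-position (inj₂ (inj₂ (inj₂ (inj₂ (refl , _))))) = 0 , refl

  first-meets-edge : ∀ {C y z} → Closed C → OnCycle y z C → first C ≢ y → first C ≢ z →
    A (first C) y ≡ true ⊎ A (first C) z ≡ true
  first-meets-edge _ (inj₁ (inj₁ (refl , refl))) v₀≢y _ = contradiction refl v₀≢y
  first-meets-edge _ (inj₁ (inj₂ (refl , refl))) _ v₀≢z = contradiction refl v₀≢z
  first-meets-edge (c₀₁ , _) (inj₂ (inj₁ (inj₁ (refl , refl)))) _ _ = inj₁ c₀₁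
  first-meets-edge (c₀₁ , _) (inj₂ (inj₁ (inj₂ (refl , refl)))) _ _ = inj₂ c₀₁
  first-meets-edge {_ , _ , _ , v₃} (_ , _ , _ , c₃₀) (inj₂ (inj₂ (inj₁ (inj₁ (refl , refl))))) _ _ =
    inj₂ (trans (A-sym _ v₃) c₃₀)
  first-meets-edge {_ , _ , _ , v₃} (_ , _ , _ , c₃₀) (inj₂ (inj₂ (inj₁ (inj₂ (refl , refl))))) _ _ =
    inj₁ (trans (A-sym _ v₃) c₃₀)
  first-meets-edge _ (inj₂ (inj₂ (inj₂ (inj₁ (refl , refl))))) _ v₀≢z = contradiction refl v₀≢z
  first-meets-edge _ (inj₂ (inj₂ (inj₂ (inj₂ (refl , refl))))) v₀≢y _ = contradiction refl v₀≢y

  cycle-vertex-meets-edge : ∀ {C x a y z} → Closed C → OnCycle x a C → OnCycle y z C → x ≢ y → x ≢ z →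
    A x y ≡ true ⊎ A x z ≡ true
  cycle-vertex-meets-edge c xa yz x≢y x≢z with onCycle-position xa
  ... | i , refl = first-meets-edge (closed-rotations i c) (onCycle-rotations i yz) x≢y x≢z

  no-common-C4 : ∀ {x a y z} → x ≢ y → x ≢ z → A x y ≡ false → A x z ≡ false → ¬ CommonC4 G x a y z
  no-common-C4 x≢y x≢z xy xz (C , (_ , closed) , xa∈C , yz∈C) with cycle-vertex-meets-edge closed xa∈C yz∈C x≢y x≢z
  ... | inj₁ xy′ = contradiction (trans (sym xy) xy′) λ ()
  ... | inj₂ xz′ = contradiction (trans (sym xz) xz′) λ ()

module NonAdjacentEdges {n} (G : Graph n) {k} (er : IsEdgeRegular (adj G) k 1) where
  open Adjacency G
  open EdgeRegularλ₁ G er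
  open FourCycles G

  neighbourhood-not-nested : ∀ {x y} → 0 < k → x ≢ y → ¬ (∀ {w} → A y w ≡ true → A x w ≡ true)
  neighbourhood-not-nested {x} {y} k>0 x≢y N[y]⊆N[x] =
    x≢y (common-neighbour-unique ab (cong₂ _∧_ (flip-adj (N[y]⊆N[x] ya)) (flip-adj (N[y]⊆N[x] yb)))
                                    (cong₂ _∧_ (flip-adj ya) (flip-adj yb)))
    where
    flip-adj : ∀ {u v} → A u v ≡ true → A v u ≡ true
    flip-adj {u} {v} uv = trans (A-sym v u) uv
    neighbour : ∃[ a ] A y a ≡ true
    neighbour = count-witness (A y) (subst (0 <_) (sym (degree≡k y)) k>0)
    a = proj₁ neighbour
    ya : A y a ≡ true
    ya = proj₂ neighbour
    triangle : ∃[ b ] (A y b ∧ A a b) ≡ true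
    triangle = count-witness (λ v → A y v ∧ A a v) (subst (0 <_) (sym (common≡1 ya)) (s≤s z≤n))
    b = proj₁ triangle
    yb : A y b ≡ true
    yb = proj₁ (∧-true (proj₂ triangle))
    ab : A a b ≡ true
    ab = proj₂ (∧-true (proj₂ triangle))

  ¬nonAdjEdgesOnC4 : 0 < k → NotComplete A → ¬ NonAdjEdgesOnC4 G
  ¬nonAdjEdgesOnC4 k>0 (x , y , x≢y , xy) on-C4 with any? (λ z → T? (A y z ∧ not (A x z)))
  ... | yes (z , yz∧xz̸) = no-common-C4 x≢y x≢z xy xz (on-C4 x a y z xa yz x≢y x≢z a≢y a≢z)
    where
    yz = proj₁ (∧-true (Equivalence.to T-≡ yz∧xz̸))
    xz = not-true (proj₂ (∧-true (Equivalence.to T-≡ yz∧xz̸)))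
    neighbour = count-witness (A x) (subst (0 <_) (sym (degree≡k x)) k>0)
    a = proj₁ neighbour
    xa = proj₂ neighbour
    x≢z : x ≢ z
    x≢z refl = contradiction (trans (sym xy) (trans (A-sym x y) yz)) λ ()
    a≢y : a ≢ y
    a≢y refl = contradiction (trans (sym xy) xa) λ ()
    a≢z : a ≢ z
    a≢z refl = contradiction (trans (sym xz) xa) λ ()
  ... | no none = neighbourhood-not-nested k>0 x≢y ⊆N[x]
    where
    ⊆N[x] : ∀ {w} → A y w ≡ true → A x w ≡ true
    ⊆N[x] {w} yw with A x w in xw
    ... | true = refl
    ... | false = contradiction (w , Equivalence.from (T-≡ {A y w ∧ not (A x w)}) (cong₂ (λ p q → p ∧ not q) yw xw)) none

theorem4 : ∀ {n} (G : Graph n) (k μ : ℕ) →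
    IsStronglyRegular (adj G) k 1 μ → Connected G → 3 ≤ k →
    EdgeRegular (gallai G) ×
    (StronglyRegular (gallai G) ⇔ (1 < μ × k ≡ 4 × NonAdjEdgesOnC4 G))
theorem4 G k μ (nonComplete , nonEmpty , er , _) _ k≥3 =
  (2 * (k ∸ 2) , k ∸ 2 ∸ 2 , gallai-isEdgeRegular) ,
  mk⇔ (⊥-elim ∘ gallai-not-stronglyRegular k≥3 nonComplete nonEmpty)
      (⊥-elim ∘ ¬nonAdjEdgesOnC4 (≤-trans (s≤s z≤n) k≥3) nonComplete ∘ proj₂ ∘ proj₂)
  where
  open GallaiOfEdgeRegularλ₁ G er
  open NonAdjacentEdges G er
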